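{- Let $n\ge 2$ and let $p=p_1\ldots p_n\in S_n$ with $mg(p)=k$. Then $mg(del(p,i))\ge k-1$ for all $i\in[n]$.
   Context: For $p\in S_n$ (one-line notation), $d_p(i,j)=|i-j|+|p_i-p_j|$ and $mg(p)=\min\{d_p(i,j):1\le i<j\le n\}$, with the convention that the minimum over the empty set (when $n=1$) is $+\infty$. For $i\in[n]$, $del(p,i)\in S_{n-1}$ is obtained by deleting the $i$th entry of $p$ and relabelling the remaining entries $1$ through $n-1$ preserving relative order. -}

module Defs where

open import Data.Nat using (ℕ; zero; suc; _+_; _≤_)
open import Data.Nat.Properties using ()
open import Data.Fin using (Fin; toℕ; _<_)
open import Data.Fin.Permutation using (Permutation′; _⟨$⟩ʳ_)
open import Data.Product using (Σ; ∃; _×_; _,_)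
open import Relation.Binary.PropositionalEquality using (_≡_)

dist : ℕ → ℕ → ℕ
dist zero    b       = b
dist (suc a) zero    = suc a
dist (suc a) (suc b) = dist a b

-- d_p(i,j) = |i-j| + |p_i - p_j|  (positions/values are 0-based Fin;
-- differences are unaffected by the shift)
d : ∀ {n} → Permutation′ n → Fin n → Fin n → ℕ
d p i j = dist (toℕ i) (toℕ j) + dist (toℕ (p ⟨$⟩ʳ i)) (toℕ (p ⟨$⟩ʳ j))

-- "k ≤ mg(p)": every pair i<j has d_p(i,j) ≥ k.
-- (With the convention min ∅ = +∞ this is vacuously true for n ≤ 1.)
_≤mg_ : ∀ {n} → ℕ → Permutation′ n → Set
k ≤mg p = ∀ i j → i < j → k ≤ d p i j

MgEq : ∀ {n} → Permutation′ n → ℕ → Set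
MgEq p k = (Σ _ λ i → Σ _ λ j → (i < j) × (d p i j ≡ k)) × (k ≤mg p)

-- Deleting entry i moves every other position and every other value by at most one, so
-- the distance d of two entries of del(p,i) is at most 2 below the distance of the
-- corresponding entries A, B of p, and exactly 2 below only if i lies between A and B in
-- both coordinates. Then d_p(A,i) + d_p(i,B) = d_p(A,B) = d + 2 with both summands at
-- least k, so d ≥ 2k - 2 ≥ k - 1; otherwise d ≥ d_p(A,B) - 1 ≥ k - 1.
module Submission where

open import Defs
open import Data.Nat using (ℕ; zero; suc; _+_; _∸_; _≤_; z≤n; s≤s; ∣_-_∣)
open import Data.Nat.Properties
  using (≤-reflexive; ≤-trans; m≤m+n; n≤1+n; +-suc; +-comm; +-mono-≤; ∸-monoˡ-≤;
         ∣-∣-comm; m≤n⇒∣m-n∣≡n∸m; m+[n∸m]≡n; <⇒≤; +-commutativeSemigroup)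
open import Algebra.Properties.CommutativeSemigroup +-commutativeSemigroup
  using (interchange)
open import Data.Fin as Fin using (Fin; toℕ; punchIn)
open import Data.Fin.Properties
  using (punchIn-mono-≤; punchIn-injective; punchInᵢ≢i; ≤∧≢⇒<; <⇒≢; ≤-total)
open import Data.Fin.Permutation using (Permutation′; remove; _⟨$⟩ʳ_; punchIn-permute)
open import Data.Product using (_×_; _,_)
open import Data.Sum using (_⊎_; inj₁; inj₂)
open import Function using (_∘_)
open import Relation.Binary.PropositionalEquality
  using (_≡_; _≢_; refl; sym; trans; cong; cong₂; subst; subst₂)
open Relation.Binary.PropositionalEquality.≡-Reasoning

dist≡∣-∣ : ∀ a b → dist a b ≡ ∣ a - b ∣
dist≡∣-∣ zero    b       = refl
dist≡∣-∣ (suc a) zero    = refl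
dist≡∣-∣ (suc a) (suc b) = dist≡∣-∣ a b

dist-comm : ∀ a b → dist a b ≡ dist b a
dist-comm a b = begin
  dist a b    ≡⟨ dist≡∣-∣ a b ⟩
  ∣ a - b ∣   ≡⟨ ∣-∣-comm a b ⟩
  ∣ b - a ∣   ≡⟨ dist≡∣-∣ b a ⟨
  dist b a    ∎

m≤n⇒m+dist≡n : ∀ {m n} → m ≤ n → m + dist m n ≡ n
m≤n⇒m+dist≡n {m} {n} m≤n = begin
  m + dist m n   ≡⟨ cong (m +_) (trans (dist≡∣-∣ m n) (m≤n⇒∣m-n∣≡n∸m m≤n)) ⟩
  m + (n ∸ m)    ≡⟨ m+[n∸m]≡n m≤n ⟩
  n              ∎

m+m≤2+n⇒m∸1≤n : ∀ m n → m + m ≤ suc (suc n) → m ∸ 1 ≤ n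
m+m≤2+n⇒m∸1≤n zero    n _ = z≤n
m+m≤2+n⇒m∸1≤n (suc m) n (s≤s m+1+m≤1+n) with subst (_≤ suc n) (+-suc m m) m+1+m≤1+n
... | s≤s m+m≤n = ≤-trans (m≤m+n m m) m+m≤n

punchIn-shift : ∀ {n} (c : Fin (suc n)) (y : Fin n) →
  toℕ (punchIn c y) ≡ toℕ y ⊎ (toℕ (punchIn c y) ≡ suc (toℕ y) × toℕ c ≤ toℕ (punchIn c y))
punchIn-shift Fin.zero    y           = inj₂ (refl , z≤n)
punchIn-shift (Fin.suc c) Fin.zero    = inj₁ refl
punchIn-shift (Fin.suc c) (Fin.suc y) with punchIn-shift c y
... | inj₁ same          = inj₁ (cong suc same)
... | inj₂ (shifted , c≤) = inj₂ (cong suc shifted , s≤s c≤)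

-- How the distance D of two points changes when a hole is punched at c, sending them to X and Y.
data PunchedDist (c X Y D : ℕ) : Set where
  unchanged : dist X Y ≡ D → PunchedDist c X Y D
  stretched : dist X Y ≡ suc D → dist X c + dist c Y ≡ suc D → PunchedDist c X Y D

PunchedDist-suc : ∀ {c X Y D} → PunchedDist c X Y D → PunchedDist (suc c) (suc X) (suc Y) D
PunchedDist-suc (unchanged e)     = unchanged e
PunchedDist-suc (stretched e via) = stretched e via

PunchedDist-sym : ∀ {c X Y D} → PunchedDist c X Y D → PunchedDist c Y X D
PunchedDist-sym {X = X} {Y} (unchanged e) = unchanged (trans (dist-comm Y X) e)
PunchedDist-sym {c} {X} {Y} (stretched e via) =
  stretched (trans (dist-comm Y X) e)
            (trans (cong₂ _+_ (dist-comm Y c) (dist-comm c X))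
                   (trans (+-comm (dist c Y) (dist X c)) via))

punchIn-dist : ∀ {n} (c : Fin (suc n)) (x y : Fin n) →
  PunchedDist (toℕ c) (toℕ (punchIn c x)) (toℕ (punchIn c y)) (dist (toℕ x) (toℕ y))
punchIn-dist Fin.zero    x           y           = unchanged refl
punchIn-dist (Fin.suc c) Fin.zero    Fin.zero    = unchanged refl
punchIn-dist (Fin.suc c) (Fin.suc x) (Fin.suc y) = PunchedDist-suc (punchIn-dist c x y)
punchIn-dist (Fin.suc c) Fin.zero    (Fin.suc y) with punchIn-shift c y
... | inj₁ same          = unchanged (cong suc same)
... | inj₂ (shifted , c≤) = stretched (cong suc shifted)
                              (cong suc (trans (m≤n⇒m+dist≡n c≤) shifted))
punchIn-dist (Fin.suc c) (Fin.suc x) Fin.zero    =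
  PunchedDist-sym (punchIn-dist (Fin.suc c) Fin.zero (Fin.suc x))

PunchedDist-+ : ∀ {c X Y D c′ X′ Y′ D′} → PunchedDist c X Y D → PunchedDist c′ X′ Y′ D′ →
  dist X Y + dist X′ Y′ ≤ suc (D + D′) ⊎
  (dist X c + dist X′ c′) + (dist c Y + dist c′ Y′) ≡ suc (suc (D + D′))
PunchedDist-+ {D = D} {D′ = D′} (unchanged e) (unchanged e′) =
  inj₁ (≤-trans (≤-reflexive (cong₂ _+_ e e′)) (n≤1+n (D + D′)))
PunchedDist-+ {D = D} {D′ = D′} (unchanged e) (stretched e′ _) =
  inj₁ (≤-reflexive (trans (cong₂ _+_ e e′) (+-suc D D′)))
PunchedDist-+ (stretched e _) (unchanged e′) = inj₁ (≤-reflexive (cong₂ _+_ e e′))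
PunchedDist-+ {c} {X} {Y} {D} {c′} {X′} {Y′} {D′} (stretched _ via) (stretched _ via′) =
  inj₂ (begin
    (dist X c + dist X′ c′) + (dist c Y + dist c′ Y′)
      ≡⟨ interchange (dist X c) (dist X′ c′) (dist c Y) (dist c′ Y′) ⟩
    (dist X c + dist c Y) + (dist X′ c′ + dist c′ Y′)
      ≡⟨ cong₂ _+_ via via′ ⟩
    suc D + suc D′
      ≡⟨ cong suc (+-suc D D′) ⟩
    suc (suc (D + D′)) ∎)

d-punchIn : ∀ {n} (p : Permutation′ (suc n)) (i : Fin (suc n)) (a b : Fin n) →
  d p (punchIn i a) (punchIn i b) ≤ suc (d (remove i p) a b) ⊎
  d p (punchIn i a) i + d p i (punchIn i b) ≡ suc (suc (d (remove i p) a b))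
d-punchIn p i a b = PunchedDist-+ (punchIn-dist i a b) values
  where
  q = remove i p
  D = dist (toℕ (q ⟨$⟩ʳ a)) (toℕ (q ⟨$⟩ʳ b))
  values : PunchedDist (toℕ (p ⟨$⟩ʳ i)) (toℕ (p ⟨$⟩ʳ punchIn i a)) (toℕ (p ⟨$⟩ʳ punchIn i b)) D
  values = subst₂ (λ U V → PunchedDist (toℕ (p ⟨$⟩ʳ i)) (toℕ U) (toℕ V) D)
                  (sym (punchIn-permute p i a)) (sym (punchIn-permute p i b))
                  (punchIn-dist (p ⟨$⟩ʳ i) (q ⟨$⟩ʳ a) (q ⟨$⟩ʳ b))

d-comm : ∀ {n} (p : Permutation′ n) X Y → d p X Y ≡ d p Y X
d-comm p X Y = cong₂ _+_ (dist-comm (toℕ X) (toℕ Y))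
                         (dist-comm (toℕ (p ⟨$⟩ʳ X)) (toℕ (p ⟨$⟩ʳ Y)))

≤mg⇒≤d : ∀ {n k} (p : Permutation′ n) → k ≤mg p → ∀ {X Y} → X ≢ Y → k ≤ d p X Y
≤mg⇒≤d {k = k} p k≤mg {X} {Y} X≢Y with ≤-total X Y
... | inj₁ X≤Y = k≤mg X Y (≤∧≢⇒< X≤Y X≢Y)
... | inj₂ Y≤X = subst (k ≤_) (d-comm p Y X) (k≤mg Y X (≤∧≢⇒< Y≤X (X≢Y ∘ sym)))

punchIn-mono-< : ∀ {n} (i : Fin (suc n)) {a b : Fin n} → a Fin.< b → punchIn i a Fin.< punchIn i b
punchIn-mono-< i {a} {b} a<b =
  ≤∧≢⇒< (punchIn-mono-≤ i a b (<⇒≤ a<b)) (<⇒≢ a<b ∘ punchIn-injective i a b)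

≤mg-remove : ∀ {n k} (p : Permutation′ (suc n)) (i : Fin (suc n)) →
  k ≤mg p → (k ∸ 1) ≤mg remove i p
≤mg-remove {k = k} p i k≤mg a b a<b with d-punchIn p i a b
... | inj₁ short  = ∸-monoˡ-≤ 1 (≤-trans (k≤mg _ _ (punchIn-mono-< i a<b)) short)
... | inj₂ detour = m+m≤2+n⇒m∸1≤n k _ (subst (k + k ≤_) detour
  (+-mono-≤ (≤mg⇒≤d p k≤mg (punchInᵢ≢i i a)) (≤mg⇒≤d p k≤mg (punchInᵢ≢i i b ∘ sym))))

corollary4 : (m : ℕ) → 1 ≤ m → (p : Permutation′ (suc m)) → (k : ℕ) →
    MgEq p k → (i : Fin (suc m)) → (k ∸ 1) ≤mg (remove i p)
corollary4 _ _ p _ (_ , k≤mg) i = ≤mg-remove p i k≤mg
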